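{- Let $\mathcal A_{\mathbf S}$ be a transitive $\mathbf S$-braid arrangement which has Property Y and satisfies $\mathcal N_{\mathbf S}=\mathcal M_{\mathbf S}$. Then $\mathcal A_{\mathbf S}$ has Property X.
   Context: Fix $n\ge1$, $[n]=\{1,\dots,n\}$, $[a;b]=\{a,\dots,b\}$. For finite sets of integers $\mathbf S=(S_{i,j})_{1\le i<j\le n}$, $\mathcal A_{\mathbf S}=\{\{x\in\mathbb R^n:x_i-x_j=s\}:i<j,\ s\in S_{i,j}\}$. For $i<j$: $S^+_{i,j}=\{s>0:s\in S_{i,j}\}$, $S^+_{j,i}=\{s\ge0:-s\in S_{i,j}\}$; $S^+_{i,i}=\emptyset$. $m=\max\bigcup_{i\ne j}S^+_{i,j}$. $\mathrm{Triple}_{\mathbf S}=\{(i,j,s):i\ne j\in[n],\ s\in S^+_{i,j}\text{ or }(s=0\text{ and }i<j)\}$. $\mathcal A_{\mathbf S}$ is transitive if for pairwise distinct $i,j,k$ and integers $s,t\ge0$, $(i,j,s)\notin\mathrm{Triple}_{\mathbf S}$ and $(j,k,t)\notin\mathrm{Triple}_{\mathbf S}$ imply $(i,k,s+t)\notin\mathrm{Triple}_{\mathbf S}$. Property X: for all $i<j$ in $[n]$, all $k\in[n]\setminus\{i,j\}$, and every $s\in S^+_{j,k}$, either $s\in S^+_{i,k}$ or ($s=0$ and $i<k$). Property Y: for all pairwise distinct $i,j,k\in[n]$ and every integer $s\ge0$ with $s>0$ or $j<i$: if $s\notin S^+_{i,j}$ then $s+t\notin S^+_{k,j}$ for all $t>0$.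 $D_{\mathbf S}$: multigraph on $[n+1]$ with $|S^+_{i,j}|$ arcs $(i,j)$ for $i\ne j$ in $[n]$ and one arc $(i,n+1)$ per $i$; $p\in\mathbb Z^n_{\ge0}$ is a $D_{\mathbf S}$-parking function if every nonempty $U\subseteq[n]$ has $u\in U$ with $p_u<$ number of arcs $(u,v)$, $v\notin U$; $\mathrm{Park}_{\mathbf S}$ is their set. An $(m,n)$-sketch is a word in which each $\alpha_i^s$ ($i\in[n]$, $s\in[0;m]$) occurs once, $\alpha_i^{s-1}$ before $\alpha_i^s$, and if $\alpha_i^{s-1}$ is before $\alpha_j^{t-1}$ then $\alpha_i^s$ is before $\alpha_j^t$ ($s,t\in[m]$). $\mathcal M_{\mathbf S}$: sketches such that whenever $\alpha_j^s$ is immediately followed by $\alpha_i^0$, $(i,j,s)\in\mathrm{Triple}_{\mathbf S}$. $\mathcal N_{\mathbf S}=\Psi(\mathrm{Park}_{\mathbf S})$, where $\Psi(p)$ is built as follows: maintain $P_r\in\mathbb Z^n$ ($P_1=p$) and ordered list $O_r$ ($O_1$ empty); Case 1: if $P_r$ has a zero entry, with $k$ the rightmost zero coordinate, $w_r=\alpha_k^0$, subtract $1$ from coordinate $k$ and from each coordinate $i$ with positive entry and $0\in S^+_{i,k}$, append $k$ to $O_r$; Case 2: if $P_r$ has no zero but $O_r\ne\emptyset$, with $k$ the first element of $O_r$ and $-s$ the $k$-th entry, $w_r=\alpha_k^s$, subtract $1$ from coordinate $k$ and each coordinate $i$ with positive entry and $s\in S^+_{i,k}$, remove $k$ from the front and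 append it at the end if $s<m$; stop when neither case applies, $\Psi(p)=w_1w_2\cdots$. -}

module Defs where

open import Data.Nat as ℕ using (ℕ; zero; suc; _+_; _*_; _⊔_)
open import Data.Integer as ℤ using (ℤ; +_; _-_; 0ℤ; ∣_∣)
open import Data.Fin as Fin using (Fin)
open import Data.Fin.Subset using (Subset; _∈_; Nonempty)
open import Data.Fin.Subset.Properties using (_∈?_)
open import Data.List using (List; allFin; []; _∷_; _++_; map; filter; concat; length; deduplicate; foldr; last; upTo)
open import Data.Nat.ListAction using (sum)
import Data.List.Membership.Propositional as LM
open import Data.List.Membership.DecPropositional ℕ._≟_ using () renaming (_∈?_ to _∈ℕ?_)
open import Data.List.Relation.Binary.Permutation.Propositional using (_↭_)
open import Data.Product using (Σ; ∃; ∃-syntax; _×_; _,_)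
open import Data.Sum using (_⊎_)
open import Data.Bool using (Bool; true; false; if_then_else_; _∧_; _∨_)
open import Data.Maybe using (Maybe; just; nothing)
open import Relation.Nullary using (¬_; does; yes; no)
open import Relation.Binary.PropositionalEquality using (_≡_; _≢_)

-- A family S = (S_{i,j})_{i<j} of finite sets of integers, represented as
-- lists; only the entries with i < j (in Fin order) are ever used.
Fam : ℕ → Set
Fam n = Fin n → Fin n → List ℤ

module _ {n : ℕ} (S : Fam n) where

  -- the elements of S^+_{i,j} (possibly with repetitions)
  plusList : Fin n → Fin n → List ℕ
  plusList i j with Fin._<?_ i j | Fin._<?_ j i
  ... | yes _ | _ = map ∣_∣ (filter (ℤ._<?_ 0ℤ) (S i j))
  ... | no _ | yes _ = map ∣_∣ (filter (λ z → z ℤ.≤? 0ℤ) (S j i))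
  ... | no _ | no _ = []

  SPlus : Fin n → Fin n → ℕ → Set
  SPlus i j s = s LM.∈ plusList i j

  card : Fin n → Fin n → ℕ
  card i j = length (deduplicate ℕ._≟_ (plusList i j))

  mS : ℕ
  mS = foldr _⊔_ 0 (concat (map (λ i → concat (map (λ j → plusList i j) (allFin n))) (allFin n)))

  Triple : Fin n → Fin n → ℕ → Set
  Triple i j s = i ≢ j × (SPlus i j s ⊎ (s ≡ 0 × i Fin.< j))

  Transitive : Set
  Transitive = ∀ (i j k : Fin n) (s t : ℕ) → i ≢ j → j ≢ k → i ≢ k →
    ¬ Triple i j s → ¬ Triple j k t → ¬ Triple i k (s + t)

  PropertyX : Set
  PropertyX = ∀ (i j k : Fin n) → i Fin.< j → k ≢ i → k ≢ j →
    ∀ s → SPlus j k s → SPlus i k s ⊎ (s ≡ 0 × i Fin.< k)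

  PropertyY : Set
  PropertyY = ∀ (i j k : Fin n) → i ≢ j → j ≢ k → i ≢ k →
    ∀ (s : ℕ) → (0 ℕ.< s ⊎ j Fin.< i) → ¬ SPlus i j s →
    ∀ (t : ℕ) → 0 ℕ.< t → ¬ SPlus k j (s + t)

  -- number of arcs (u,v) of D_S with v ∉ U (v ∈ [n+1]); the arc (u,n+1)
  -- always counts since n+1 ∉ U ⊆ [n].
  outArcs : Subset n → Fin n → ℕ
  outArcs U u = suc (sum (map (λ v → if does (v ∈? U) then 0 else card u v) (allFin n)))

  IsPark : (Fin n → ℕ) → Set
  IsPark p = ∀ (U : Subset n) → Nonempty U → ∃[ u ] (u ∈ U × p u ℕ.< outArcs U u)

  -- letters α_i^s are pairs (i , s); words are lists of letters
  Letter : Set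
  Letter = Fin n × ℕ

  Word : Set
  Word = List Letter

  allLetters : Word
  allLetters = concat (map (λ i → map (λ s → (i , s)) (upTo (suc mS))) (allFin n))

  Before : Word → Letter → Letter → Set
  Before w a b = ∃[ xs ] ∃[ ys ] ∃[ zs ] (w ≡ xs ++ a ∷ ys ++ b ∷ zs)

  ImmBefore : Word → Letter → Letter → Set
  ImmBefore w a b = ∃[ xs ] ∃[ zs ] (w ≡ xs ++ a ∷ b ∷ zs)

  IsSketch : Word → Set
  IsSketch w =
    (w ↭ allLetters) ×
    (∀ (i : Fin n) (s : ℕ) → suc s ℕ.≤ mS → Before w (i , s) (i , suc s)) ×
    (∀ (i j : Fin n) (s t : ℕ) → suc s ℕ.≤ mS → suc t ℕ.≤ mS →
       Before w (i , s) (j , t) → Before w (i , suc s) (j , suc t))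

  InM : Word → Set
  InM w = IsSketch w ×
    (∀ (i j : Fin n) (s : ℕ) → ImmBefore w (j , s) (i , 0) → Triple i j s)

  State : Set
  State = (Fin n → ℤ) × List (Fin n)

  update : (Fin n → ℤ) → Fin n → ℕ → Fin n → ℤ
  update P k s i =
    if does (i Fin.≟ k) ∨ (does (0ℤ ℤ.<? P i) ∧ does (s ∈ℕ? plusList i k))
    then P i - + 1 else P i

  -- one step of the construction; nothing = neither case applies
  step : State → Maybe (Letter × State)
  step (P , O) with last (filter (λ i → P i ℤ.≟ 0ℤ) (allFin n))
  ... | just k = just ((k , 0) , (update P k 0 , O ++ k ∷ []))
  ... | nothing with O
  ...   | [] = nothing
  ...   | k ∷ O' = let s = ∣ P k ∣ in
                   just ((k , s) , (update P k s ,
                     (if does (s ℕ.<? mS) then O' ++ k ∷ [] else O')))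

  -- iterate with fuel; n * (mS + 2) steps always suffice (each k is chosen
  -- once in Case 1 and at most max(mS,1) times in Case 2), so the fuel never
  -- cuts the process short.
  run : ℕ → State → Word
  run zero st = []
  run (suc f) st with step st
  ... | nothing = []
  ... | just (a , st') = a ∷ run f st'

  Ψ : (Fin n → ℕ) → Word
  Ψ p = run (n * (mS + 2)) ((λ i → + p i) , [])

  InN : Word → Set
  InN w = ∃[ p ] (IsPark p × Ψ p ≡ w)

  NeqM : Set
  NeqM = ∀ (w : Word) → (InN w → InM w) × (InM w → InN w)

-- Suppose i < j and s ∈ S⁺_{j,k}, but neither s ∈ S⁺_{i,k} nor (s = 0 and i < k). Sort all
-- letters by level t (lifted by s for i and j), then by decreasing index, placing α_j and α_i
-- right after α_k. The result is a sketch in M_S containing the factor α_k^s α_j^0 α_i^0, so it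
-- is Ψ(p) for a parking function p. Emitting α_i^0 needs a zero i-th entry, and the two steps
-- before could not have decreased that entry (0 ∉ S⁺_{i,j}, s ∉ S⁺_{i,k}). So it was already
-- zero when α_k^s was emitted, which forces Case 1 with s = 0 and i ≤ k: a contradiction.

module Submission where

open import Defs
open import Data.Nat using (ℕ; _≤_)

open import Data.Nat as ℕ
  using (suc; _+_; _*_; _∸_; _%_; _⊔_; _<_; z≤n; s≤s; z<s; s<s)
open import Data.Nat.Properties
  using ( +-cancelʳ-≡; *-cancelʳ-≡; *-cancelʳ-<; +-comm; +-suc; +-identityʳ; *-identityˡ
        ; m≤m+n; m≤n+m; m<n+m; +-monoʳ-<; m∸n≤m; ∸-cancelˡ-≡; ∸-monoʳ-≤
        ; ≤-refl; ≤-trans; <⇒≤; ≤-<-trans; <-≤-trans; <-irrefl; <-asym; <⇒≱; ≰⇒>; ≮⇒≥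
        ; ≤∧≢⇒<; n<1+n; n<1⇒n≡0; 1+n≢n; m+n≡0⇒m≡0; m+n≡0⇒n≡0; m≤m⊔n; m≤n⊔m
        ; ≤-decTotalOrder )
open import Data.Nat.DivMod using ([m+kn]%n≡m%n; m<n⇒m%n≡m)
open import Data.Nat.Tactic.RingSolver using (solve-∀)
open import Data.Integer as ℤ using (ℤ; 0ℤ; ∣_∣)
open import Data.Integer.Properties as ℤₚ using (∣i∣≡0⇒i≡0)
open import Data.Fin as Fin using (Fin; toℕ)
import Data.Fin.Properties as Finₚ
open import Data.List
  using ( List; []; _∷_; _++_; [_]; map; concat; filter; foldr; last; allFin; upTo
        ; cartesianProduct )
open import Data.List.Properties using (++-assoc)
open import Data.List.Relation.Unary.All as All using ()
open import Data.List.Relation.Unary.AllPairs as AllPairs using (AllPairs; _∷_)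
open import Data.List.Relation.Unary.AllPairs.Properties using (tabulate⁺-<; filter⁺)
open import Data.List.Relation.Unary.Any using (here; there)
open import Data.List.Relation.Unary.Unique.Propositional using (Unique)
open import Data.List.Relation.Unary.Unique.Propositional.Properties
  using (cartesianProduct⁺; allFin⁺; upTo⁺)
open import Data.List.Relation.Unary.Sorted.TotalOrder.Properties using (Sorted⇒AllPairs)
open import Data.List.Membership.Propositional using (_∈_; _∉_)
open import Data.List.Membership.Propositional.Properties
  using ( ∈-∃++; ∈-++⁺ʳ; ∈-map⁺; ∈-map⁻; ∈-concat⁺′; ∈-filter⁺; ∈-filter⁻; ∈-allFin; ∈-upTo⁺
        ; ∈-cartesianProduct⁺ )
open import Data.List.Membership.DecPropositional ℕ._≟_ using () renaming (_∈?_ to _∈ℕ?_)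
open import Data.List.Relation.Binary.Permutation.Propositional using (_↭_; ↭-sym; ↭⇒↭ₛ)
open import Data.List.Relation.Binary.Permutation.Propositional.Properties using (∈-resp-↭)
open import Data.List.Relation.Binary.Permutation.Setoid.Properties using (Unique-resp-↭)
import Data.List.Sort as Sort
open import Data.Maybe using (just; nothing)
open import Data.Maybe.Properties using (just-injective)
open import Data.Product using (∃-syntax; _×_; _,_; proj₂)
open import Data.Product.Properties using (,-injectiveˡ; ,-injectiveʳ)
open import Data.Sum using (_⊎_; inj₁; inj₂)
open import Data.Bool.Properties using (∧-zeroʳ)
open import Data.Empty using (⊥-elim)
open import Function using (_on_; _∘_; id)
open import Relation.Binary.Bundles using (DecTotalOrder)
import Relation.Binary.Construct.On as On
open import Relation.Nullary using (¬_; does; yes; no)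
open import Relation.Nullary.Decidable using (_×-dec_; dec-false)
open import Relation.Binary.PropositionalEquality
  using (_≡_; _≢_; refl; sym; trans; cong; subst; subst₂; module ≡-Reasoning)
open import Relation.Binary.PropositionalEquality.Properties using (setoid)

m*d+r≡n*d+s⇒m≡n×r≡s : ∀ d {m n r s} → r < d → s < d →
                       m * d + r ≡ n * d + s → m ≡ n × r ≡ s
m*d+r≡n*d+s⇒m≡n×r≡s d@(suc _) {m} {n} {r} {s} r<d s<d eq = m≡n , r≡s
  where
  remainder : ∀ q {x} → x < d → (q * d + x) % d ≡ x
  remainder q {x} x<d = begin
    (q * d + x) % d ≡⟨ cong (_% d) (+-comm (q * d) x) ⟩
    (x + q * d) % d ≡⟨ [m+kn]%n≡m%n x q d ⟩
    x % d           ≡⟨ m<n⇒m%n≡m x<d ⟩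
    x               ∎
    where open ≡-Reasoning

  r≡s : r ≡ s
  r≡s = trans (sym (remainder m r<d)) (trans (cong (_% d) eq) (remainder n s<d))

  m≡n : m ≡ n
  m≡n = *-cancelʳ-≡ m n d (+-cancelʳ-≡ r (m * d) (n * d) (trans eq (cong (n * d +_) (sym r≡s))))

m*d+r<n*d⇒m<n : ∀ d {m n r} → m * d + r < n * d → m < n
m*d+r<n*d⇒m<n d {m} {n} {r} lt = *-cancelʳ-< d m n (≤-<-trans (m≤m+n (m * d) r) lt)

≤-foldr-⊔ : ∀ {x xs} → x ∈ xs → x ≤ foldr _⊔_ 0 xs
≤-foldr-⊔ {xs = y ∷ _}  (here refl) = m≤m⊔n y _
≤-foldr-⊔ {xs = y ∷ xs} (there x∈) = ≤-trans (≤-foldr-⊔ x∈) (m≤n⊔m y _)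

concat-map-pairs≡cartesianProduct : ∀ {A B : Set} (xs : List A) (ys : List B) →
  concat (map (λ x → map (x ,_) ys) xs) ≡ cartesianProduct xs ys
concat-map-pairs≡cartesianProduct []       ys = refl
concat-map-pairs≡cartesianProduct (x ∷ xs) ys =
  cong (map (x ,_) ys ++_) (concat-map-pairs≡cartesianProduct xs ys)

module _ {A : Set} where

  last-∈ : ∀ {xs : List A} {x} → last xs ≡ just x → x ∈ xs
  last-∈ {_ ∷ []}     refl = here refl
  last-∈ {_ ∷ _ ∷ xs} eq   = there (last-∈ {_ ∷ xs} eq)

  last-nothing⇒∉ : ∀ {xs : List A} {y} → last xs ≡ nothing → y ∉ xs
  last-nothing⇒∉ {_ ∷ []}     () _
  last-nothing⇒∉ {_ ∷ _ ∷ xs} eq _ = last-nothing⇒∉ {_ ∷ xs} eq (here refl)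

  last-maximal : ∀ {R : A → A → Set} {xs x y} → AllPairs R xs → last xs ≡ just x → y ∈ xs →
                 y ≡ x ⊎ R y x
  last-maximal {xs = _ ∷ []}     _                refl (here refl) = inj₁ refl
  last-maximal {xs = _ ∷ _ ∷ xs} (R-rest ∷ _)     eq   (here refl) =
    inj₂ (All.lookup R-rest (last-∈ {_ ∷ xs} eq))
  last-maximal {xs = _ ∷ _ ∷ xs} (_ ∷ rest-sorted) eq   (there y∈) =
    last-maximal rest-sorted eq y∈

allFin-sorted : ∀ n → AllPairs Fin._<_ (allFin n)
allFin-sorted n = tabulate⁺-< id

module _ {A : Set} (key : A → ℕ) where

  StrictlySorted : List A → Set
  StrictlySorted = AllPairs (_<_ on key)

  sorted-suffix : ∀ xs {ys} → StrictlySorted (xs ++ ys) → StrictlySorted ys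
  sorted-suffix []       sorted       = sorted
  sorted-suffix (_ ∷ xs) (_ ∷ sorted) = sorted-suffix xs sorted

  locate-by-key : ∀ xs {a ys c} → StrictlySorted (xs ++ a ∷ ys) → c ∈ xs ++ a ∷ ys →
                  key c < key a ⊎ c ≡ a ⊎ (c ∈ ys × key a < key c)
  locate-by-key []       _           (here refl)  = inj₂ (inj₁ refl)
  locate-by-key []       (a< ∷ _)    (there c∈ys) = inj₂ (inj₂ (c∈ys , All.lookup a< c∈ys))
  locate-by-key (_ ∷ xs) (x< ∷ _)    (here refl)  = inj₁ (All.lookup x< (∈-++⁺ʳ xs (here refl)))
  locate-by-key (_ ∷ xs) (_ ∷ sorted) (there c∈)  = locate-by-key xs sorted c∈

  <-of-before : ∀ {ws xs ys zs a b} → StrictlySorted ws → ws ≡ xs ++ a ∷ ys ++ b ∷ zs →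
                key a < key b
  <-of-before {xs = xs} {ys} sorted refl with a< ∷ _ ← sorted-suffix xs sorted =
    All.lookup a< (∈-++⁺ʳ ys (here refl))

  before-of-< : ∀ {ws a b} → StrictlySorted ws → a ∈ ws → b ∈ ws → key a < key b →
                ∃[ xs ] ∃[ ys ] ∃[ zs ] (ws ≡ xs ++ a ∷ ys ++ b ∷ zs)
  before-of-< sorted a∈ b∈ a<b with xs , _ , refl ← ∈-∃++ a∈ with locate-by-key xs sorted b∈
  ... | inj₁ b<a                = ⊥-elim (<-asym a<b b<a)
  ... | inj₂ (inj₁ refl)        = ⊥-elim (<-irrefl refl a<b)
  ... | inj₂ (inj₂ (b∈ys , _)) with ys , zs , refl ← ∈-∃++ b∈ys = xs , ys , zs , refl

  successor-follows : ∀ {ws xs a ys b} → StrictlySorted ws → ws ≡ xs ++ a ∷ ys → b ∈ ws →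
                      key b ≡ suc (key a) → ∃[ zs ] (ys ≡ b ∷ zs)
  successor-follows {xs = xs} sorted refl b∈ b≡1+a with locate-by-key xs sorted b∈
  ... | inj₁ b<a                      = ⊥-elim (<-asym b<a (subst (key _ <_) (sym b≡1+a) (n<1+n _)))
  ... | inj₂ (inj₁ refl)              = ⊥-elim (1+n≢n (sym b≡1+a))
  ... | inj₂ (inj₂ (here refl , _))   = _ , refl
  ... | inj₂ (inj₂ (there b∈ , _))
    with a< ∷ (y< ∷ _) ← sorted-suffix xs sorted =
    ⊥-elim (<⇒≱ (All.lookup a< (here refl))
                 (ℕ.s≤s⁻¹ (subst (key _ <_) b≡1+a (All.lookup y< b∈))))

  predecessor : ∀ {ws xs a b zs c} → StrictlySorted ws → ws ≡ xs ++ a ∷ b ∷ zs → c ∈ ws →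
                key b ≡ suc (key c) → a ≡ c
  predecessor {xs = xs} sorted refl c∈ b≡1+c with locate-by-key xs sorted c∈
  ... | inj₂ (inj₁ refl)            = refl
  ... | inj₂ (inj₂ (here refl , _)) = ⊥-elim (1+n≢n (sym b≡1+c))
  ... | inj₂ (inj₂ (there c∈ , _)) with _ ∷ (b< ∷ _) ← sorted-suffix xs sorted =
    ⊥-elim (<-asym (All.lookup b< c∈) (subst (key _ <_) (sym b≡1+c) (n<1+n _)))
  ... | inj₁ c<a with a< ∷ _ ← sorted-suffix xs sorted =
    ⊥-elim (<⇒≱ (All.lookup a< (here refl)) (subst (_≤ key _) (sym b≡1+c) c<a))

  private
    keyOrder : DecTotalOrder _ _ _
    keyOrder = On.decTotalOrder ≤-decTotalOrder key

  sortOn : List A → List A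
  sortOn = Sort.sort keyOrder

  sortOn-↭ : ∀ xs → sortOn xs ↭ xs
  sortOn-↭ = Sort.sort-↭ keyOrder

  sortOn-strictlySorted : (∀ {x y} → key x ≡ key y → x ≡ y) →
                          ∀ {xs} → Unique xs → StrictlySorted (sortOn xs)
  sortOn-strictlySorted key-injective {xs} unique = AllPairs.zipWith
    (λ (x≤y , x≢y) → ≤∧≢⇒< x≤y (x≢y ∘ key-injective))
    ( Sorted⇒AllPairs (DecTotalOrder.totalOrder keyOrder) (Sort.sort-↗ keyOrder xs)
    , Unique-resp-↭ (setoid A) (↭⇒↭ₛ (↭-sym (sortOn-↭ xs))) unique )

module _ {n : ℕ} (S : Fam n) where

  0∉S⁺-< : ∀ {a b} → a Fin.< b → ¬ SPlus S a b 0
  0∉S⁺-< {a} {b} a<b 0∈ with a Fin.<? b | b Fin.<? a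
  ... | no a≮b | _ = a≮b a<b
  ... | yes _  | _
    with z , z∈ , 0≡∣z∣ ← ∈-map⁻ ∣_∣ 0∈
    with _ , 0<z ← ∈-filter⁻ (ℤ._<?_ 0ℤ) {xs = S a b} z∈
    with refl ← ∣i∣≡0⇒i≡0 {z} (sym 0≡∣z∣) = ℤₚ.<-irrefl refl 0<z

  update-other : ∀ P {x t y} → y ≢ x → ¬ SPlus S y x t → update S P x t y ≡ P y
  update-other P {x} {t} {y} y≢x t∉S⁺
    rewrite dec-false (y Fin.≟ x) y≢x | dec-false (t ∈ℕ? plusList S y x) t∉S⁺
          | ∧-zeroʳ (does (0ℤ ℤ.<? P y)) = refl

  zeros : (Fin n → ℤ) → List (Fin n)
  zeros P = filter (λ i → P i ℤ.≟ 0ℤ) (allFin n)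

  ∈-zeros⁺ : ∀ {P y} → P y ≡ 0ℤ → y ∈ zeros P
  ∈-zeros⁺ {P} {y} = ∈-filter⁺ (λ i → P i ℤ.≟ 0ℤ) (∈-allFin y)

  ∈-zeros⁻ : ∀ {P y} → y ∈ zeros P → P y ≡ 0ℤ
  ∈-zeros⁻ {P} = proj₂ ∘ ∈-filter⁻ (λ i → P i ℤ.≟ 0ℤ) {xs = allFin n}

  step-update : ∀ {P O x t P′ O′} → step S (P , O) ≡ just ((x , t) , (P′ , O′)) →
                P′ ≡ update S P x t
  step-update {P} {O} eq with last (zeros P)
  step-update refl | just _ = refl
  step-update {O = O} eq | nothing with O
  step-update ()   | nothing | []
  step-update refl | nothing | _ ∷ _ = refl

  zero-before-step : ∀ {P O x t P′ O′ y} → step S (P , O) ≡ just ((x , t) , (P′ , O′)) →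
                     y ≢ x → ¬ SPlus S y x t → P′ y ≡ 0ℤ → P y ≡ 0ℤ
  zero-before-step {P} eq y≢x t∉S⁺ P′y≡0 =
    trans (sym (update-other P y≢x t∉S⁺)) (trans (cong (λ Q → Q _) (sym (step-update eq))) P′y≡0)

  step-letter⁰ : ∀ {P O x st} → step S (P , O) ≡ just ((x , 0) , st) → P x ≡ 0ℤ
  step-letter⁰ {P} {O} eq with last (zeros P) in last≡
  ... | just _ with refl ← eq = ∈-zeros⁻ (last-∈ {xs = zeros P} last≡)
  ... | nothing with O
  ...   | _ ∷ _ with letter≡ ← ,-injectiveˡ (just-injective eq)
                with refl ← ,-injectiveˡ letter≡ = ∣i∣≡0⇒i≡0 (,-injectiveʳ letter≡)

  step-rightmost-zero : ∀ {P O x t st y} → P y ≡ 0ℤ → step S (P , O) ≡ just ((x , t) , st) →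
                        t ≡ 0 × (y ≡ x ⊎ y Fin.< x)
  step-rightmost-zero {P} {y = y} Py≡0 eq with last (zeros P) in last≡
  ... | just _ with refl ← eq =
    refl , last-maximal (filter⁺ _ (allFin-sorted n)) last≡ (∈-zeros⁺ Py≡0)
  ... | nothing = ⊥-elim (last-nothing⇒∉ {xs = zeros P} last≡ (∈-zeros⁺ Py≡0))

  run-head : ∀ f st {a ys} → run S f st ≡ a ∷ ys →
             ∃[ st′ ] ∃[ f′ ] (step S st ≡ just (a , st′) × run S f′ st′ ≡ ys)
  run-head (suc f) st eq with step S st
  run-head (suc f) st ()   | nothing
  run-head (suc f) st refl | just (_ , st′) = st′ , f , refl , refl

  run-suffix : ∀ f st xs {ys} → run S f st ≡ xs ++ ys → ∃[ f′ ] ∃[ st′ ] (run S f′ st′ ≡ ys)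
  run-suffix f st []       eq = f , st , eq
  run-suffix f st (_ ∷ xs) eq with st′ , f′ , _ , eq′ ← run-head f st eq =
    run-suffix f′ st′ xs eq′

  run-αₖˢαⱼ⁰αᵢ⁰ : ∀ f st {i j k s xs zs} → i Fin.< j → k ≢ i →
                   run S f st ≡ xs ++ (k , s) ∷ (j , 0) ∷ (i , 0) ∷ zs →
                   SPlus S i k s ⊎ (s ≡ 0 × i Fin.< k)
  run-αₖˢαⱼ⁰αᵢ⁰ f st {i} {k = k} {s} {xs} i<j k≢i run≡
    with s ∈ℕ? plusList S i k
  ... | yes s∈S⁺ᵢₖ = inj₁ s∈S⁺ᵢₖ
  ... | no s∉S⁺ᵢₖ
    with f₁ , (P₁ , O₁) , run₁ ← run-suffix f st xs run≡
    with (P₂ , O₂) , f₂ , step₁ , run₂ ← run-head f₁ (P₁ , O₁) run₁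
    with st₃ , f₃ , step₂ , run₃ ← run-head f₂ (P₂ , O₂) run₂
    with _ , _ , step₃ , _ ← run-head f₃ st₃ run₃
    with P₁i≡0 ← zero-before-step step₁ (k≢i ∘ sym) s∉S⁺ᵢₖ
                   (zero-before-step step₂ (Finₚ.<⇒≢ i<j) (0∉S⁺-< i<j) (step-letter⁰ step₃))
    with step-rightmost-zero P₁i≡0 step₁
  ... | _   , inj₁ i≡k = ⊥-elim (k≢i (sym i≡k))
  ... | s≡0 , inj₂ i<k = inj₂ (s≡0 , i<k)

  Ψ-αₖˢαⱼ⁰αᵢ⁰ : ∀ p {i j k s xs zs} → i Fin.< j → k ≢ i →
                 Ψ S p ≡ xs ++ (k , s) ∷ (j , 0) ∷ (i , 0) ∷ zs →
                 SPlus S i k s ⊎ (s ≡ 0 × i Fin.< k)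
  Ψ-αₖˢαⱼ⁰αᵢ⁰ p = run-αₖˢαⱼ⁰αᵢ⁰ (n * (mS S + 2)) ((λ a → ℤ.+ p a) , [])

SPlus-≤-mS : ∀ {n} (S : Fam n) a b {t} → SPlus S a b t → t ≤ mS S
SPlus-≤-mS {n} S a b t∈ = ≤-foldr-⊔ (∈-concat⁺′ (∈-concat⁺′ t∈ S⁺ₐ∈) (∈-map⁺ _ (∈-allFin a)))
  where S⁺ₐ∈ = ∈-map⁺ (plusList S a) (∈-allFin b)

module Witness {n : ℕ} (S : Fam n) {i j k : Fin n} {s : ℕ}
               (i<j : i Fin.< j) (k≢i : k ≢ i) (k≢j : k ≢ j) (s∈S⁺ⱼₖ : SPlus S j k s)
               (¬s≡0×i<k : ¬ (s ≡ 0 × i Fin.< k)) where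

  s≡0⇒k<i : s ≡ 0 → k Fin.< i
  s≡0⇒k<i s≡0 = Finₚ.≤∧≢⇒< (≮⇒≥ (λ i<k → ¬s≡0×i<k (s≡0 , i<k))) k≢i

  s≤mS : s ≤ mS S
  s≤mS = SPlus-≤-mS S j k s∈S⁺ⱼₖ

  i≢j : i ≢ j
  i≢j = Finₚ.<⇒≢ i<j

  data Role (a : Fin n) : Set where
    is-j  : a ≡ j → Role a
    is-i  : a ≡ i → Role a
    other : a ≢ i → a ≢ j → Role a

  role : (a : Fin n) → Role a
  role a with a Fin.≟ j | a Fin.≟ i
  ... | yes a≡j | _       = is-j a≡j
  ... | no _    | yes a≡i = is-i a≡i
  ... | no a≢j  | no a≢i  = other a≢i a≢j

  anchor : ∀ {a} → Role a → Fin n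
  anchor     (is-j _)    = k
  anchor     (is-i _)    = k
  anchor {a} (other _ _) = a

  lift : ∀ {a} → Role a → ℕ
  lift (is-j _)    = s
  lift (is-i _)    = s
  lift (other _ _) = 0

  offset : ∀ {a} → Role a → ℕ
  offset (is-j _)    = 1
  offset (is-i _)    = 2
  offset (other _ _) = 0

  complement : Fin n → ℕ
  complement a = n ∸ toℕ a

  -- Letters are ordered by level t + lift, then by decreasing index of the anchor, then by
  -- offset; so α_j^t and α_i^t come right after α_k^(t+s).
  slot : ∀ {a} → Role a → ℕ → ℕ
  slot r t = (t + lift r) * suc n + complement (anchor r)

  position : ∀ {a} → Role a → ℕ → ℕ
  position r t = slot r t * 3 + offset r

  key : Letter S → ℕ
  key (a , t) = position (role a) t

  offset<3 : ∀ {a} (r : Role a) → offset r < 3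
  offset<3 (is-j _)    = s<s z<s
  offset<3 (is-i _)    = s<s (s<s z<s)
  offset<3 (other _ _) = z<s

  complement<1+n : ∀ a → complement a < suc n
  complement<1+n a = s≤s (m∸n≤m n (toℕ a))

  complement-injective : ∀ {a b} → complement a ≡ complement b → a ≡ b
  complement-injective {a} {b} =
    Finₚ.toℕ-injective ∘ ∸-cancelˡ-≡ (<⇒≤ (Finₚ.toℕ<n a)) (<⇒≤ (Finₚ.toℕ<n b))

  complement-<⇒> : ∀ {a b} → complement a < complement b → b Fin.< a
  complement-<⇒> lt = ≰⇒> (λ a≤b → <⇒≱ lt (∸-monoʳ-≤ n a≤b))

  role-injective : ∀ {a b} (r : Role a) (r′ : Role b) →
                   anchor r ≡ anchor r′ → offset r ≡ offset r′ → a ≡ b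
  role-injective (is-j refl) (is-j refl) _   _  = refl
  role-injective (is-i refl) (is-i refl) _   _  = refl
  role-injective (other _ _) (other _ _) a≡b _  = a≡b
  role-injective (is-j _)    (is-i _)    _   ()
  role-injective (is-j _)    (other _ _) _   ()
  role-injective (is-i _)    (is-j _)    _   ()
  role-injective (is-i _)    (other _ _) _   ()
  role-injective (other _ _) (is-j _)    _   ()
  role-injective (other _ _) (is-i _)    _   ()

  key-injective : ∀ {x y} → key x ≡ key y → x ≡ y
  key-injective {a , t} {b , u} eq
    with slot≡ , offset≡ ← m*d+r≡n*d+s⇒m≡n×r≡s 3 {slot (role a) t} {slot (role b) u}
                             (offset<3 (role a)) (offset<3 (role b)) eq
    with level≡ , complement≡ ← m*d+r≡n*d+s⇒m≡n×r≡s (suc n) {t + lift (role a)} {u + lift (role b)}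
                                  (complement<1+n (anchor (role a)))
                                  (complement<1+n (anchor (role b))) slot≡
    with refl ← role-injective (role a) (role b) (complement-injective complement≡) offset≡ =
    cong (a ,_) (+-cancelʳ-≡ (lift (role a)) t u level≡)

  key-suc : ∀ a t → key (a , suc t) ≡ suc n * 3 + key (a , t)
  key-suc a t = shift (t + lift (role a)) (suc n) (complement (anchor (role a))) (offset (role a))
    where
    shift : ∀ l d r o → (suc l * d + r) * 3 + o ≡ d * 3 + ((l * d + r) * 3 + o)
    shift = solve-∀

  key-other : ∀ {x} t → x ≢ i → x ≢ j → key (x , t) ≡ (t * suc n + complement x) * 3
  key-other {x} t x≢i x≢j with role x
  ... | is-j x≡j  = ⊥-elim (x≢j x≡j)
  ... | is-i x≡i  = ⊥-elim (x≢i x≡i)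
  ... | other _ _ rewrite +-identityʳ t = +-identityʳ _

  key-j : ∀ t → key (j , t) ≡ ((t + s) * suc n + complement k) * 3 + 1
  key-j t with role j
  ... | is-j _      = refl
  ... | is-i j≡i    = ⊥-elim (i≢j (sym j≡i))
  ... | other _ j≢j = ⊥-elim (j≢j refl)

  key-i : ∀ t → key (i , t) ≡ ((t + s) * suc n + complement k) * 3 + 2
  key-i t with role i
  ... | is-j i≡j    = ⊥-elim (i≢j i≡j)
  ... | is-i _      = refl
  ... | other i≢i _ = ⊥-elim (i≢i refl)

  key-j-after-k : key (j , 0) ≡ suc (key (k , s))
  key-j-after-k = begin
    key (j , 0)                          ≡⟨ key-j 0 ⟩
    (s * suc n + complement k) * 3 + 1   ≡⟨ +-comm _ 1 ⟩
    suc ((s * suc n + complement k) * 3) ≡⟨ cong suc (key-other s k≢i k≢j) ⟨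
    suc (key (k , s))                    ∎
    where open ≡-Reasoning

  key-i-after-j : key (i , 0) ≡ suc (key (j , 0))
  key-i-after-j = begin
    key (i , 0)                              ≡⟨ key-i 0 ⟩
    (s * suc n + complement k) * 3 + 2       ≡⟨ +-suc _ 1 ⟩
    suc ((s * suc n + complement k) * 3 + 1) ≡⟨ cong suc (key-j 0) ⟨
    suc (key (j , 0))                        ∎
    where open ≡-Reasoning

  level-zero-and-anchor : ∀ {x y} (r : Role y) t → position r t < complement x * 3 →
                          t + lift r ≡ 0 × x Fin.< anchor r
  level-zero-and-anchor {x} r t lt =
    n<1⇒n≡0 level<1 , complement-<⇒> (≤-<-trans (m≤n+m _ _) slot<)
    where
    slot< : slot r t < complement x
    slot< = m*d+r<n*d⇒m<n 3 lt

    level<1 : t + lift r < 1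
    level<1 = m*d+r<n*d⇒m<n (suc n)
      (<-≤-trans slot< (subst (complement x ≤_) (sym (*-identityˡ (suc n)))
                              (<⇒≤ (complement<1+n x))))

  anchor-≤ : ∀ {y} (r : Role y) → lift r ≡ 0 → anchor r Fin.≤ y
  anchor-≤ (is-j refl) s≡0 = <⇒≤ (Finₚ.<-trans (s≡0⇒k<i s≡0) i<j)
  anchor-≤ (is-i refl) s≡0 = <⇒≤ (s≡0⇒k<i s≡0)
  anchor-≤ (other _ _) _   = ≤-refl

  earlier-than-other : ∀ {x y t} → x ≢ i → x ≢ j → key (y , t) < key (x , 0) →
                       t ≡ 0 × x Fin.< y
  earlier-than-other {x} {y} {t} x≢i x≢j lt
    with level≡0 , x<anchor ← level-zero-and-anchor (role y) t
                                (subst (key (y , t) <_) (key-other 0 x≢i x≢j) lt) =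
    m+n≡0⇒m≡0 t level≡0 , <-≤-trans x<anchor (anchor-≤ (role y) (m+n≡0⇒n≡0 t level≡0))

  allLetters≡cartesianProduct : allLetters S ≡ cartesianProduct (allFin n) (upTo (suc (mS S)))
  allLetters≡cartesianProduct = concat-map-pairs≡cartesianProduct (allFin n) (upTo (suc (mS S)))

  ∈-allLetters : ∀ a {t} → t ≤ mS S → (a , t) ∈ allLetters S
  ∈-allLetters a t≤m = subst ((a , _) ∈_) (sym allLetters≡cartesianProduct)
    (∈-cartesianProduct⁺ (∈-allFin a) (∈-upTo⁺ (s≤s t≤m)))

  allLetters-unique : Unique (allLetters S)
  allLetters-unique = subst Unique (sym allLetters≡cartesianProduct)
    (cartesianProduct⁺ (allFin⁺ n) (upTo⁺ (suc (mS S))))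

  w : Word S
  w = sortOn key (allLetters S)

  w-sorted : StrictlySorted key w
  w-sorted = sortOn-strictlySorted key key-injective allLetters-unique

  ∈-w : ∀ a {t} → t ≤ mS S → (a , t) ∈ w
  ∈-w a t≤m = ∈-resp-↭ (↭-sym (sortOn-↭ key (allLetters S))) (∈-allLetters a t≤m)

  w-sketch : IsSketch S w
  w-sketch = sortOn-↭ key (allLetters S) , before-next , before-both-next
    where
    before-next : ∀ a t → suc t ≤ mS S → Before S w (a , t) (a , suc t)
    before-next a t t<m = before-of-< key w-sorted (∈-w a (<⇒≤ t<m)) (∈-w a t<m)
      (subst (key (a , t) <_) (sym (key-suc a t)) (m<n+m (key (a , t)) {suc n * 3} z<s))

    before-both-next : ∀ a b t u → suc t ≤ mS S → suc u ≤ mS S →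
                       Before S w (a , t) (b , u) → Before S w (a , suc t) (b , suc u)
    before-both-next a b t u t<m u<m (_ , _ , _ , w≡) =
      before-of-< key w-sorted (∈-w a t<m) (∈-w b u<m)
        (subst₂ _<_ (sym (key-suc a t)) (sym (key-suc b u))
                (+-monoʳ-< (suc n * 3) (<-of-before key w-sorted w≡)))

  w-triples : ∀ x y t → ImmBefore S w (y , t) (x , 0) → Triple S x y t
  w-triples x y t (_ , _ , w≡) with role x
  ... | is-j refl
    with refl ← predecessor key w-sorted w≡ (∈-w k s≤mS) key-j-after-k =
    (k≢j ∘ sym) , inj₁ s∈S⁺ⱼₖ
  ... | is-i refl
    with refl ← predecessor key w-sorted w≡ (∈-w j z≤n) key-i-after-j =
    i≢j , inj₂ (refl , i<j)
  ... | other x≢i x≢j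
    with refl , x<y ← earlier-than-other {t = t} x≢i x≢j (<-of-before key {ys = []} w-sorted w≡) =
    Finₚ.<⇒≢ x<y , inj₂ (refl , x<y)

  w-αₖˢαⱼ⁰αᵢ⁰ : ∃[ xs ] ∃[ zs ] (w ≡ xs ++ (k , s) ∷ (j , 0) ∷ (i , 0) ∷ zs)
  w-αₖˢαⱼ⁰αᵢ⁰
    with xs , _ , w≡ ← ∈-∃++ (∈-w k s≤mS)
    with _ , refl ← successor-follows key w-sorted w≡ (∈-w j z≤n) key-j-after-k
    with zs , refl ← successor-follows key w-sorted (trans w≡ (sym (++-assoc xs [ k , s ] _)))
                                        (∈-w i z≤n) key-i-after-j =
    xs , zs , w≡

  M-contains-αₖˢαⱼ⁰αᵢ⁰ :
    ∃[ w ] (InM S w × ∃[ xs ] ∃[ zs ] (w ≡ xs ++ (k , s) ∷ (j , 0) ∷ (i , 0) ∷ zs))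
  M-contains-αₖˢαⱼ⁰αᵢ⁰ = w , (w-sketch , w-triples) , w-αₖˢαⱼ⁰αᵢ⁰

lemma5p3 : (n : ℕ) → 1 ≤ n → (S : Fam n) →
    Transitive S → PropertyY S → NeqM S → PropertyX S
lemma5p3 n _ S _ _ N≡M i j k i<j k≢i k≢j s s∈S⁺ⱼₖ with (s ℕ.≟ 0) ×-dec (i Fin.<? k)
... | yes s≡0×i<k = inj₂ s≡0×i<k
... | no ¬s≡0×i<k
  with w , w∈M , _ , _ , w≡ ← Witness.M-contains-αₖˢαⱼ⁰αᵢ⁰ S i<j k≢i k≢j s∈S⁺ⱼₖ ¬s≡0×i<k
  with p , _ , Ψp≡w ← proj₂ (N≡M w) w∈M =
  Ψ-αₖˢαⱼ⁰αᵢ⁰ S p i<j k≢i (trans Ψp≡w w≡)
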